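{- Let $G$ be a graph of maximum degree $\Delta$ and let $v$ be a vertex of $G$. Then $b^I_g(G)\le b^A_g(G-v)+2\Delta+\deg(v)$ and $b^A_g(G)\ge b^I_g(G-v)-2\Delta-\deg(v)$.
   Context: The balance game on a finite simple graph $G$ is played by two players, Admirable (A) and Impish (I), who alternately select a not-yet-labeled vertex of $G$ until all vertices are labeled; Admirable labels each vertex she selects by $0$ and Impish labels each vertex he selects by $1$. Each edge receives the sum modulo $2$ of the labels of its endpoints. Let $e_0$ and $e_1$ be the numbers of edges labeled $0$ and $1$ at the end; the discrepancy is $d=e_1-e_0$. Admirable tries to minimize $d$ and Impish tries to maximize $d$. $b^A_g(G)$ is the value of $d$ under optimal play of both players when Admirable moves first, and $b^I_g(G)$ is the value under optimal play when Impish moves first. $G-v$ denotes the graph obtained by deleting $v$. -}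

module Defs where

open import Data.Bool using (Bool; true; false; _∧_; _xor_; if_then_else_)
open import Data.Nat using (ℕ; zero; suc; _<ᵇ_) renaming (_⊔_ to _⊔ℕ_)
open import Data.Fin using (Fin; toℕ; punchIn; _≟_)
open import Data.Fin.Properties using (punchIn-injective)
open import Data.List using (List; []; _∷_; map; foldr; allFin; filter; length)
open import Data.Maybe using (Maybe; just; nothing; is-nothing; fromMaybe)
open import Data.Integer using (ℤ; +_; -_; _+_; _⊓_; _⊔_)
open import Relation.Nullary using (yes; no)
open import Relation.Binary.PropositionalEquality using (_≡_)

record Graph (n : ℕ) : Set where
  field
    adj    : Fin n → Fin n → Bool
    sym    : ∀ i j → adj i j ≡ adj j i
    irrefl : ∀ i → adj i i ≡ false
open Graph public

deg : ∀ {n} → Graph n → Fin n → ℕ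
deg G v = length (filter (λ j → Data.Bool._≟_ (adj G v j) true) (allFin _))

maxDeg : ∀ {n} → Graph n → ℕ
maxDeg {n} G = foldr _⊔ℕ_ 0 (map (deg G) (allFin n))

delete : ∀ {m} → Graph (suc m) → Fin (suc m) → Graph m
delete G v = record
  { adj    = λ i j → adj G (punchIn v i) (punchIn v j)
  ; sym    = λ i j → sym G (punchIn v i) (punchIn v j)
  ; irrefl = λ i → irrefl G (punchIn v i) }

-- Partial labelings: nothing = not yet labeled, just false = 0, just true = 1
Labeling : ℕ → Set
Labeling n = Fin n → Maybe Bool

emptyLab : ∀ {n} → Labeling n
emptyLab _ = nothing

setLab : ∀ {n} → Labeling n → Fin n → Bool → Labeling n
setLab L u b w with w ≟ u
... | yes _ = just b
... | no  _ = L w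

unlabeled : ∀ {n} → Labeling n → List (Fin n)
unlabeled {n} L = filter (λ w → Data.Bool._≟_ (is-nothing (L w)) true) (allFin n)

-- discrepancy e₁ - e₀ : each edge {i,j} (counted once, toℕ i < toℕ j)
-- contributes +1 if labelled 1 (labels differ), -1 if labelled 0.
-- (Only evaluated on complete labelings in the game.)
sumℤ : List ℤ → ℤ
sumℤ = foldr _+_ (+ 0)

disc : ∀ {n} → Graph n → Labeling n → ℤ
disc {n} G L = sumℤ (map (λ i → sumℤ (map (λ j → edgeVal i j) (allFin n))) (allFin n))
  where
  lab : Fin n → Bool
  lab w = fromMaybe false (L w)
  edgeVal : Fin n → Fin n → ℤ
  edgeVal i j = if adj G i j ∧ (toℕ i <ᵇ toℕ j)
                then (if lab i xor lab j then + 1 else - (+ 1))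
                else + 0

data Player : Set where
  Admirable Impish : Player

other : Player → Player
other Admirable = Impish
other Impish    = Admirable

mark : Player → Bool
mark Admirable = false
mark Impish    = true

best : Player → ℤ → ℤ → ℤ
best Admirable = _⊓_
best Impish    = _⊔_

bestOf : Player → ℤ → List ℤ → ℤ
bestOf p x []       = x
bestOf p x (y ∷ ys) = best p x (bestOf p y ys)

-- minimax value with p to move; fuel k bounds the number of remaining moves
-- (fuel n from the empty labeling suffices to label all n vertices).
value : ∀ {n} → Graph n → ℕ → Player → Labeling n → ℤ
value G zero    p L = disc G L
value G (suc k) p L with unlabeled L
... | []     = disc G L
... | u ∷ us = bestOf p (move u) (map move us)
  where
  move : _ → ℤ
  move w = value G k (other p) (setLab L w (mark p))

bgA : ∀ {n} → Graph n → ℤ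
bgA {n} G = value G n Admirable emptyLab

bgI : ∀ {n} → Graph n → ℤ
bgI {n} G = value G n Impish emptyLab

-- Let Impish's best first move on G label the vertex u. The rest of that game is
-- compared with the Admirable-first game on G − v by matching the vertices of G
-- other than u with those of G − v, the copy of u sitting at v. Matched positions
-- stay matched move by move, so the two values differ by at most the largest
-- difference of final discrepancies. Giving u the label of v changes the
-- discrepancy of G by at most 2 deg u ≤ 2Δ, after which deleting v changes it by
-- at most deg v. The second inequality is the same comparison, with Admirable's
-- best first move on G as the extra move.

module Submission where

open import Defs hiding (sym)
open import Data.Nat using (ℕ; suc; zero; _<ᵇ_; z≤n; s≤s)
  renaming (_≤_ to _≤ℕ_; _+_ to _+ℕ_; _*_ to _*ℕ_; _⊔_ to _⊔ℕ_)
import Data.Nat.Properties as ℕ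
open import Data.Bool using (Bool; true; false; _∧_; _xor_; if_then_else_) renaming (_≟_ to _≟ᵇ_)
open import Data.Bool.Properties using (xor-comm)
open import Data.Fin using (Fin; toℕ; punchIn; punchOut; _≟_)
open import Data.Fin.Properties using (toℕ-injective; punchIn-injective; punchInᵢ≢i; punchIn-punchOut)
open import Data.List using (List; []; _∷_; map; foldr; allFin; filter; length; tabulate)
open import Data.List.Properties using (map-tabulate)
open import Data.List.Membership.Propositional using (_∈_)
open import Data.List.Membership.Propositional.Properties
  using (∈-allFin; ∈-filter⁺; ∈-filter⁻; ∈-map⁺; ∈-map⁻)
open import Data.List.Relation.Unary.Any using (here; there)
open import Data.Maybe using (just; nothing; fromMaybe; is-nothing)
open import Data.Product using (_×_; _,_; proj₂; ∃-syntax)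
open import Data.Sum using (_⊎_; inj₁; inj₂)
open import Data.Vec.Functional using (updateAt)
open import Data.Vec.Functional.Properties using (updateAt-updates; updateAt-minimal)
open import Data.Integer using (ℤ; +_; -_; -[1+_]; _+_; _-_; _*_; _≤_; +≤+; -≤+; ∣_∣)
open import Data.Integer.Properties as ℤ using (+-0-commutativeMonoid)
open import Data.Integer.Tactic.RingSolver using (solve-∀)
open import Algebra.Properties.CommutativeMonoid.Sum +-0-commutativeMonoid
  using (sum; sum-syntax; sum-remove; sum-cong-≗; ∑-distrib-+)
open import Function using (id; _∘_)
open import Relation.Nullary using (yes; no; contradiction)
open import Relation.Nullary.Reflects using (ofʸ; ofⁿ)
open import Relation.Binary.PropositionalEquality
  using (_≡_; _≢_; _≗_; refl; sym; trans; cong; cong₂; subst; module ≡-Reasoning)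

sumℤ-tabulate : ∀ {n} (f : Fin n → ℤ) → sumℤ (tabulate f) ≡ sum f
sumℤ-tabulate {zero}  f = refl
sumℤ-tabulate {suc n} f = cong (_+_ (f Fin.zero)) (sumℤ-tabulate (f ∘ Fin.suc))

sumℤ-map-allFin : ∀ {n} (f : Fin n → ℤ) → sumℤ (map f (allFin n)) ≡ sum f
sumℤ-map-allFin f = trans (cong sumℤ (map-tabulate id f)) (sumℤ-tabulate f)

i≤+∣i∣ : ∀ i → i ≤ + ∣ i ∣
i≤+∣i∣ (+ n)    = ℤ.≤-refl
i≤+∣i∣ -[1+ n ] = -≤+

∣i-j∣≤k⇒i≤j+k : ∀ {i j k} → ∣ i - j ∣ ≤ℕ k → i ≤ j + + k
∣i-j∣≤k⇒i≤j+k {i} {j} {k} ∣i-j∣≤k = begin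
  i                 ≡⟨ i≡j+[i-j] i j ⟩
  j + (i - j)       ≤⟨ ℤ.+-monoʳ-≤ j (i≤+∣i∣ (i - j)) ⟩
  j + + ∣ i - j ∣   ≤⟨ ℤ.+-monoʳ-≤ j (+≤+ ∣i-j∣≤k) ⟩
  j + + k           ∎
  where
  open ℤ.≤-Reasoning
  i≡j+[i-j] : ∀ i j → i ≡ j + (i - j)
  i≡j+[i-j] = solve-∀

i≤j+[k+l]⇒i-k-l≤j : ∀ {i j k l} → i ≤ j + (k + l) → i - k - l ≤ j
i≤j+[k+l]⇒i-k-l≤j {i} {j} {k} {l} i≤j+[k+l] = begin
  i - k - l              ≤⟨ ℤ.+-monoˡ-≤ (- l) (ℤ.+-monoˡ-≤ (- k) i≤j+[k+l]) ⟩
  j + (k + l) - k - l    ≡⟨ cancel j k l ⟩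
  j                      ∎
  where
  open ℤ.≤-Reasoning
  cancel : ∀ j k l → j + (k + l) - k - l ≡ j
  cancel = solve-∀

∣i-k∣≤∣i-j∣+∣j-k∣ : ∀ i j k → ∣ i - k ∣ ≤ℕ ∣ i - j ∣ +ℕ ∣ j - k ∣
∣i-k∣≤∣i-j∣+∣j-k∣ i j k =
  subst (λ d → ∣ d ∣ ≤ℕ ∣ i - j ∣ +ℕ ∣ j - k ∣) (ℤ.+-minus-telescope i j k)
        (ℤ.∣i+j∣≤∣i∣+∣j∣ (i - j) (j - k))

-- Discrepancy of Boolean labellings

edgeSign : Bool → Bool → ℤ
edgeSign a b = if a xor b then + 1 else - + 1

edgeSign-comm : ∀ a b → edgeSign a b ≡ edgeSign b a
edgeSign-comm a b = cong (if_then + 1 else - + 1) (xor-comm a b)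

∣edgeSign∣≡1 : ∀ a b → ∣ edgeSign a b ∣ ≡ 1
∣edgeSign∣≡1 a b with a xor b
... | true  = refl
... | false = refl

adjacent⇒≢ : ∀ {n} (G : Graph n) {i j} → adj G i j ≡ true → i ≢ j
adjacent⇒≢ G {i} ij refl with trans (sym ij) (irrefl G i)
... | ()

labelOf : ∀ {n} → Labeling n → Fin n → Bool
labelOf L w = fromMaybe false (L w)

module _ {n} (G : Graph n) (lab : Fin n → Bool) where

  edgeValue : Fin n → Fin n → ℤ
  edgeValue i j = if adj G i j then edgeSign (lab i) (lab j) else + 0

  orderedEdgeValue : Fin n → Fin n → ℤ
  orderedEdgeValue i j =
    if adj G i j ∧ (toℕ i <ᵇ toℕ j) then edgeSign (lab i) (lab j) else + 0

  discrepancy : ℤ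
  discrepancy = ∑[ i < n ] ∑[ j < n ] orderedEdgeValue i j

  edgeValue-diag : ∀ i → edgeValue i i ≡ + 0
  edgeValue-diag i rewrite irrefl G i = refl

  orderedEdgeValue-diag : ∀ i → orderedEdgeValue i i ≡ + 0
  orderedEdgeValue-diag i rewrite irrefl G i = refl

  orderedEdgeValue-+-swap : ∀ i j → orderedEdgeValue i j + orderedEdgeValue j i ≡ edgeValue i j
  orderedEdgeValue-+-swap i j rewrite Graph.sym G j i with adj G i j in ij
  ... | false = refl
  ... | true with toℕ i <ᵇ toℕ j | ℕ.<ᵇ-reflects-< (toℕ i) (toℕ j)
                | toℕ j <ᵇ toℕ i | ℕ.<ᵇ-reflects-< (toℕ j) (toℕ i)
  ...   | true  | ofʸ i<j  | true  | ofʸ j<i  = contradiction i<j (ℕ.<-asym j<i)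
  ...   | true  | _        | false | _        = ℤ.+-identityʳ _
  ...   | false | _        | true  | _        = trans (ℤ.+-identityˡ _) (edgeSign-comm (lab j) (lab i))
  ...   | false | ofⁿ i≮j  | false | ofⁿ j≮i  =
    contradiction (toℕ-injective (ℕ.≤-antisym (ℕ.≮⇒≥ j≮i) (ℕ.≮⇒≥ i≮j))) (adjacent⇒≢ G ij)

disc≡discrepancy : ∀ {n} (G : Graph n) (L : Labeling n) → disc G L ≡ discrepancy G (labelOf L)
disc≡discrepancy {n} G L = trans
  (sumℤ-map-allFin λ i → sumℤ (map (orderedEdgeValue G lab i) (allFin n)))
  (sum-cong-≗ λ i → sumℤ-map-allFin (orderedEdgeValue G lab i))
  where lab = labelOf L

discrepancy-cong : ∀ {n} (G : Graph n) {lab lab′ : Fin n → Bool} →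
  lab ≗ lab′ → discrepancy G lab ≡ discrepancy G lab′
discrepancy-cong G eq = sum-cong-≗ λ i → sum-cong-≗ λ j →
  cong₂ (λ a b → if adj G i j ∧ (toℕ i <ᵇ toℕ j) then edgeSign a b else + 0) (eq i) (eq j)

punchIn-<ᵇ : ∀ {m} (v : Fin (suc m)) (w w′ : Fin m) →
  (toℕ (punchIn v w) <ᵇ toℕ (punchIn v w′)) ≡ (toℕ w <ᵇ toℕ w′)
punchIn-<ᵇ Fin.zero    w           w′           = refl
punchIn-<ᵇ (Fin.suc v) Fin.zero    Fin.zero     = refl
punchIn-<ᵇ (Fin.suc v) Fin.zero    (Fin.suc w′) = refl
punchIn-<ᵇ (Fin.suc v) (Fin.suc w) Fin.zero     = refl
punchIn-<ᵇ (Fin.suc v) (Fin.suc w) (Fin.suc w′) = punchIn-<ᵇ v w w′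

incidentDiscrepancy : ∀ {m} → Graph (suc m) → (Fin (suc m) → Bool) → Fin (suc m) → ℤ
incidentDiscrepancy {m} G lab v = ∑[ w < m ] edgeValue G lab v (punchIn v w)

discrepancy-delete : ∀ {m} (G : Graph (suc m)) lab v →
  discrepancy G lab ≡ incidentDiscrepancy G lab v + discrepancy (delete G v) (lab ∘ punchIn v)
discrepancy-delete {m} G lab v = begin
  ∑[ i < suc m ] ∑[ j < suc m ] e i j
    ≡⟨ sum-remove {i = v} (λ i → ∑[ j < suc m ] e i j) ⟩
  ∑[ j < suc m ] e v j + ∑[ w < m ] ∑[ j < suc m ] e (p w) j
    ≡⟨ cong₂ _+_ (sum-remove {i = v} (e v)) (sum-cong-≗ λ w → sum-remove {i = v} (e (p w))) ⟩
  (e v v + out) + ∑[ w < m ] (e (p w) v + ∑[ w′ < m ] e (p w) (p w′))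
    ≡⟨ cong₂ _+_ (trans (cong (_+ out) (orderedEdgeValue-diag G lab v)) (ℤ.+-identityˡ out))
                 (∑-distrib-+ (λ w → e (p w) v) (λ w → ∑[ w′ < m ] e (p w) (p w′))) ⟩
  out + (into + rest)
    ≡⟨ sym (ℤ.+-assoc out into rest) ⟩
  (out + into) + rest
    ≡⟨ cong₂ _+_ (trans (sym (∑-distrib-+ (λ w → e v (p w)) (λ w → e (p w) v)))
                        (sum-cong-≗ λ w → orderedEdgeValue-+-swap G lab v (p w)))
                 (sum-cong-≗ λ w → sum-cong-≗ λ w′ → ordered-punchIn w w′) ⟩
  incidentDiscrepancy G lab v + discrepancy (delete G v) (lab ∘ p)
    ∎
  where
  open ≡-Reasoning
  e = orderedEdgeValue G lab
  p = punchIn v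
  out into rest : ℤ
  out  = ∑[ w < m ] e v (p w)
  into = ∑[ w < m ] e (p w) v
  rest = ∑[ w < m ] ∑[ w′ < m ] e (p w) (p w′)
  ordered-punchIn : ∀ w w′ → e (p w) (p w′) ≡ orderedEdgeValue (delete G v) (lab ∘ p) w w′
  ordered-punchIn w w′ rewrite punchIn-<ᵇ v w w′ = refl

module _ {n} (G : Graph n) (lab : Fin n → Bool) (v : Fin n) where

  private
    neighbours : List (Fin n) → List (Fin n)
    neighbours = filter (λ j → adj G v j ≟ᵇ true)

  ∣sum-edgeValue∣≤#neighbours : ∀ xs →
    ∣ sumℤ (map (edgeValue G lab v) xs) ∣ ≤ℕ length (neighbours xs)
  ∣sum-edgeValue∣≤#neighbours []       = z≤n
  ∣sum-edgeValue∣≤#neighbours (x ∷ xs) with adj G v x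
  ... | true  = begin
    ∣ edgeSign (lab v) (lab x) + rest ∣      ≤⟨ ℤ.∣i+j∣≤∣i∣+∣j∣ (edgeSign (lab v) (lab x)) rest ⟩
    ∣ edgeSign (lab v) (lab x) ∣ +ℕ ∣ rest ∣ ≡⟨ cong (_+ℕ ∣ rest ∣) (∣edgeSign∣≡1 (lab v) (lab x)) ⟩
    suc ∣ rest ∣                             ≤⟨ s≤s (∣sum-edgeValue∣≤#neighbours xs) ⟩
    suc (length (neighbours xs))             ∎
    where
    open ℕ.≤-Reasoning
    rest = sumℤ (map (edgeValue G lab v) xs)
  ... | false = subst (λ k → ∣ k ∣ ≤ℕ length (neighbours xs)) (sym (ℤ.+-identityˡ rest))
                      (∣sum-edgeValue∣≤#neighbours xs)
    where
    rest = sumℤ (map (edgeValue G lab v) xs)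

∣incidentDiscrepancy∣≤deg : ∀ {m} (G : Graph (suc m)) lab v →
  ∣ incidentDiscrepancy G lab v ∣ ≤ℕ deg G v
∣incidentDiscrepancy∣≤deg {m} G lab v =
  subst (λ k → ∣ k ∣ ≤ℕ deg G v) row≡incident
        (∣sum-edgeValue∣≤#neighbours G lab v (allFin (suc m)))
  where
  open ≡-Reasoning
  incident = incidentDiscrepancy G lab v
  row≡incident : sumℤ (map (edgeValue G lab v) (allFin (suc m))) ≡ incident
  row≡incident = begin
    sumℤ (map (edgeValue G lab v) (allFin (suc m)))  ≡⟨ sumℤ-map-allFin (edgeValue G lab v) ⟩
    sum (edgeValue G lab v)                          ≡⟨ sum-remove {i = v} (edgeValue G lab v) ⟩
    edgeValue G lab v v + incident                   ≡⟨ cong (_+ incident) (edgeValue-diag G lab v) ⟩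
    + 0 + incident                                   ≡⟨ ℤ.+-identityˡ incident ⟩
    incident                                         ∎

∣discrepancy-delete∣≤deg : ∀ {m} (G : Graph (suc m)) lab v →
  ∣ discrepancy G lab - discrepancy (delete G v) (lab ∘ punchIn v) ∣ ≤ℕ deg G v
∣discrepancy-delete∣≤deg G lab v =
  subst (λ k → ∣ k ∣ ≤ℕ deg G v)
        (trans (sym ([r+d]-d≡r incident rest)) (cong (_- rest) (sym (discrepancy-delete G lab v))))
        (∣incidentDiscrepancy∣≤deg G lab v)
  where
  incident = incidentDiscrepancy G lab v
  rest = discrepancy (delete G v) (lab ∘ punchIn v)
  [r+d]-d≡r : ∀ r d → (r + d) - d ≡ r
  [r+d]-d≡r = solve-∀

∣discrepancy-relabel∣≤2*deg : ∀ {m} (G : Graph (suc m)) {lab lab′} x →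
  (∀ y → y ≢ x → lab y ≡ lab′ y) →
  ∣ discrepancy G lab - discrepancy G lab′ ∣ ≤ℕ 2 *ℕ deg G x
∣discrepancy-relabel∣≤2*deg G {lab} {lab′} x agree = begin
  ∣ d lab - d lab′ ∣                   ≤⟨ ∣i-k∣≤∣i-j∣+∣j-k∣ (d lab) (d′ lab) (d lab′) ⟩
  ∣ d lab - d′ lab ∣ +ℕ ∣ d′ lab - d lab′ ∣
    ≡⟨ cong (λ r → ∣ d lab - d′ lab ∣ +ℕ ∣ r - d lab′ ∣) d′lab≡d′lab′ ⟩
  ∣ d lab - d′ lab ∣ +ℕ ∣ d′ lab′ - d lab′ ∣
    ≡⟨ cong (∣ d lab - d′ lab ∣ +ℕ_) (ℤ.∣i-j∣≡∣j-i∣ (d′ lab′) (d lab′)) ⟩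
  ∣ d lab - d′ lab ∣ +ℕ ∣ d lab′ - d′ lab′ ∣
    ≤⟨ ℕ.+-mono-≤ (∣discrepancy-delete∣≤deg G lab x) -- 2 *ℕ k reduces to k +ℕ (k +ℕ 0)
                  (ℕ.≤-trans (∣discrepancy-delete∣≤deg G lab′ x) (ℕ.m≤m+n (deg G x) 0)) ⟩
  2 *ℕ deg G x                         ∎
  where
  open ℕ.≤-Reasoning
  d : (Fin _ → Bool) → ℤ
  d = discrepancy G
  d′ : (Fin _ → Bool) → ℤ
  d′ ℓ = discrepancy (delete G x) (ℓ ∘ punchIn x)
  d′lab≡d′lab′ : d′ lab ≡ d′ lab′
  d′lab≡d′lab′ = discrepancy-cong (delete G x) λ w → agree (punchIn x w) (punchInᵢ≢i x w)

≤-max : ∀ {A : Set} (f : A → ℕ) {x} {xs} → x ∈ xs → f x ≤ℕ foldr _⊔ℕ_ 0 (map f xs)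
≤-max f {xs = y ∷ ys} (here refl) = ℕ.m≤m⊔n (f y) _
≤-max f {xs = y ∷ ys} (there x∈ys) = ℕ.m≤n⇒m≤o⊔n (f y) (≤-max f x∈ys)

deg≤maxDeg : ∀ {n} (G : Graph n) v → deg G v ≤ℕ maxDeg G
deg≤maxDeg G v = ≤-max (deg G) (∈-allFin v)

module _ {m} (u v : Fin (suc m)) where

  -- ι matches the vertices of G − v with those of G other than u: it is punchIn v,
  -- except that the vertex punchIn v would send to u is sent to v.
  ι : Fin m → Fin (suc m)
  ι w with punchIn v w ≟ u
  ... | yes _ = v
  ... | no  _ = punchIn v w

  ι-≢ : ∀ w → ι w ≢ u
  ι-≢ w with punchIn v w ≟ u
  ... | yes p≡u = λ v≡u → punchInᵢ≢i v w (trans p≡u (sym v≡u))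
  ... | no  p≢u = p≢u

  ι-injective : ∀ w w′ → ι w ≡ ι w′ → w ≡ w′
  ι-injective w w′ eq with punchIn v w ≟ u | punchIn v w′ ≟ u
  ... | yes p≡u | yes p′≡u = punchIn-injective v w w′ (trans p≡u (sym p′≡u))
  ... | yes _   | no  _    = contradiction (sym eq) (punchInᵢ≢i v w′)
  ... | no  _   | yes _    = contradiction eq (punchInᵢ≢i v w)
  ... | no  _   | no  _    = punchIn-injective v w w′ eq

  ι-punchIn : ∀ w → punchIn v w ≢ u → ι w ≡ punchIn v w
  ι-punchIn w p≢u with punchIn v w ≟ u
  ... | yes p≡u = contradiction p≡u p≢u
  ... | no  _   = refl

  ι-punchIn≡u : ∀ w → punchIn v w ≡ u → ι w ≡ v
  ι-punchIn≡u w p≡u with punchIn v w ≟ u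
  ... | yes _   = refl
  ... | no  p≢u = contradiction p≡u p≢u

  ι-surjective : ∀ x → x ≢ u → ∃[ w ] ι w ≡ x
  ι-surjective x x≢u with x ≟ v
  ... | yes x≡v = w , trans (ι-punchIn≡u w (punchIn-punchOut v≢u)) (sym x≡v)
    where
    v≢u : v ≢ u
    v≢u v≡u = x≢u (trans x≡v v≡u)
    w = punchOut v≢u
  ... | no x≢v = w , trans (ι-punchIn w (x≢u ∘ trans (sym p≡x))) p≡x
    where
    w = punchOut (x≢v ∘ sym)
    p≡x = punchIn-punchOut (x≢v ∘ sym)

  ∘ι≗moved∘punchIn : ∀ (lab : Fin (suc m) → Bool) →
    lab ∘ ι ≗ updateAt lab u (λ _ → lab v) ∘ punchIn v
  ∘ι≗moved∘punchIn lab w with punchIn v w ≟ u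
  ... | yes refl = sym (updateAt-updates (punchIn v w) {λ _ → lab v} lab)
  ... | no  p≢u  = sym (updateAt-minimal (punchIn v w) u {λ _ → lab v} lab p≢u)

  ∣discrepancy-delete-ι∣≤2*deg+deg : ∀ (G : Graph (suc m)) lab →
    ∣ discrepancy G lab - discrepancy (delete G v) (lab ∘ ι) ∣ ≤ℕ 2 *ℕ deg G u +ℕ deg G v
  ∣discrepancy-delete-ι∣≤2*deg+deg G lab = begin
    ∣ d lab - d′ (lab ∘ ι) ∣
      ≤⟨ ∣i-k∣≤∣i-j∣+∣j-k∣ (d lab) (d moved) (d′ (lab ∘ ι)) ⟩
    ∣ d lab - d moved ∣ +ℕ ∣ d moved - d′ (lab ∘ ι) ∣
      ≡⟨ cong (λ x → ∣ d lab - d moved ∣ +ℕ ∣ d moved - x ∣)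
              (discrepancy-cong (delete G v) (∘ι≗moved∘punchIn lab)) ⟩
    ∣ d lab - d moved ∣ +ℕ ∣ d moved - d′ (moved ∘ punchIn v) ∣
      ≤⟨ ℕ.+-mono-≤ (∣discrepancy-relabel∣≤2*deg G u moved-agrees)
                    (∣discrepancy-delete∣≤deg G moved v) ⟩
    2 *ℕ deg G u +ℕ deg G v
      ∎
    where
    open ℕ.≤-Reasoning
    d  = discrepancy G
    d′ = discrepancy (delete G v)
    moved = updateAt lab u (λ _ → lab v)
    moved-agrees : ∀ y → y ≢ u → lab y ≡ moved y
    moved-agrees y y≢u = sym (updateAt-minimal y u lab y≢u)

module _ {n} (L : Labeling n) where

  private
    unlabeled? = λ w → is-nothing (L w) ≟ᵇ true

  ∈-unlabeled⁺ : ∀ {x} → L x ≡ nothing → x ∈ unlabeled L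
  ∈-unlabeled⁺ {x} Lx≡nothing =
    ∈-filter⁺ unlabeled? (∈-allFin x) (cong is-nothing Lx≡nothing)

  ∈-unlabeled⁻ : ∀ {x} → x ∈ unlabeled L → L x ≡ nothing
  ∈-unlabeled⁻ {x} x∈ with L x | proj₂ (∈-filter⁻ unlabeled? {xs = allFin n} x∈)
  ... | nothing | _ = refl

  setLab-≡ : ∀ x b → setLab L x b x ≡ just b
  setLab-≡ x b with x ≟ x
  ... | yes _   = refl
  ... | no  x≢x = contradiction refl x≢x

  setLab-≢ : ∀ {x y} b → y ≢ x → setLab L x b y ≡ L y
  setLab-≢ {x} {y} b y≢x with y ≟ x
  ... | yes y≡x = contradiction y≡x y≢x
  ... | no  _   = refl

-- Game values

best-sel : ∀ p x y → best p x y ≡ x ⊎ best p x y ≡ y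
best-sel Admirable = ℤ.⊓-sel
best-sel Impish    = ℤ.⊔-sel

bestOf-∈ : ∀ p x xs → bestOf p x xs ∈ x ∷ xs
bestOf-∈ p x []       = here refl
bestOf-∈ p x (y ∷ ys) with best-sel p x (bestOf p y ys)
... | inj₁ eq = here eq
... | inj₂ eq = there (subst (_∈ y ∷ ys) (sym eq) (bestOf-∈ p y ys))

≤-bestOf-Impish : ∀ {y} x xs → y ∈ x ∷ xs → y ≤ bestOf Impish x xs
≤-bestOf-Impish x []       (here refl)  = ℤ.≤-refl
≤-bestOf-Impish x (z ∷ zs) (here refl)  = ℤ.i≤i⊔j x _
≤-bestOf-Impish x (z ∷ zs) (there y∈)   = ℤ.≤-trans (≤-bestOf-Impish z zs y∈) (ℤ.i≤j⊔i x _)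

bestOf-Admirable-≤ : ∀ {y} x xs → y ∈ x ∷ xs → bestOf Admirable x xs ≤ y
bestOf-Admirable-≤ x []       (here refl)  = ℤ.≤-refl
bestOf-Admirable-≤ x (z ∷ zs) (here refl)  = ℤ.i⊓j≤i x _
bestOf-Admirable-≤ x (z ∷ zs) (there y∈)   = ℤ.≤-trans (ℤ.i⊓j≤j x _) (bestOf-Admirable-≤ z zs y∈)

module _ {n} (G : Graph n) where

  value-finished : ∀ {k p L} → unlabeled L ≡ [] → value G (suc k) p L ≡ disc G L
  value-finished eq rewrite eq = refl

  value-attained : ∀ {k p L x} → x ∈ unlabeled L →
    ∃[ y ] y ∈ unlabeled L × value G (suc k) p L ≡ value G k (other p) (setLab L y (mark p))
  value-attained {k} {p} {L} x∈ with unlabeled L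
  ... | u ∷ us = ∈-map⁻ move (bestOf-∈ p (move u) (map move us))
    where
    move : Fin n → ℤ
    move w = value G k (other p) (setLab L w (mark p))

  value-Impish-≥ : ∀ {k L x} → x ∈ unlabeled L →
    value G k Admirable (setLab L x true) ≤ value G (suc k) Impish L
  value-Impish-≥ {k} {L} x∈ with unlabeled L
  ... | u ∷ us = ≤-bestOf-Impish (move u) (map move us) (∈-map⁺ move x∈)
    where
    move : Fin n → ℤ
    move w = value G k Admirable (setLab L w true)

  value-Admirable-≤ : ∀ {k L x} → x ∈ unlabeled L →
    value G (suc k) Admirable L ≤ value G k Impish (setLab L x false)
  value-Admirable-≤ {k} {L} x∈ with unlabeled L
  ... | u ∷ us = bestOf-Admirable-≤ (move u) (map move us) (∈-map⁺ move x∈)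
    where
    move : Fin n → ℤ
    move w = value G k Impish (setLab L w false)

[]⊎∈ : ∀ {A : Set} (xs : List A) → xs ≡ [] ⊎ ∃[ x ] x ∈ xs
[]⊎∈ []      = inj₁ refl
[]⊎∈ (x ∷ _) = inj₂ (x , here refl)

module Simulation {n n′} (G : Graph n) (G′ : Graph n′) (c : ℤ)
  (R : Labeling n → Labeling n′ → Set)
  (disc-≤ : ∀ {L M} → R L M → disc G L ≤ disc G′ M + c)
  (forth : ∀ {L M} → R L M → ∀ {x} → x ∈ unlabeled L →
           ∃[ w ] w ∈ unlabeled M × (∀ b → R (setLab L x b) (setLab M w b)))
  (back : ∀ {L M} → R L M → ∀ {w} → w ∈ unlabeled M →
          ∃[ x ] x ∈ unlabeled L × (∀ b → R (setLab L x b) (setLab M w b)))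
  where

  open ℤ.≤-Reasoning

  finished-back : ∀ {L M} → R L M → unlabeled L ≡ [] → unlabeled M ≡ []
  finished-back {L} {M} r L-done with []⊎∈ (unlabeled M)
  ... | inj₁ M-done  = M-done
  ... | inj₂ (w , w∈) =
    let x , x∈ , _ = back r w∈ in contradiction (subst (x ∈_) L-done x∈) λ ()

  value-≤ : ∀ k p {L M} → R L M → value G k p L ≤ value G′ k p M + c
  value-≤ zero p r = disc-≤ r
  value-≤ (suc k) p {L} {M} r with []⊎∈ (unlabeled L)
  ... | inj₁ L-done = begin
    value G (suc k) p L       ≡⟨ value-finished G L-done ⟩
    disc G L                  ≤⟨ disc-≤ r ⟩
    disc G′ M + c             ≡⟨ cong (_+ c) (value-finished G′ (finished-back r L-done)) ⟨
    value G′ (suc k) p M + c  ∎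
  value-≤ (suc k) Impish {L} {M} r | inj₂ (x , x∈) =
    let y , y∈ , eq = value-attained G {k} {Impish} x∈
        w , w∈ , r′ = forth r y∈
    in begin
    value G (suc k) Impish L                   ≡⟨ eq ⟩
    value G k Admirable (setLab L y true)      ≤⟨ value-≤ k Admirable (r′ true) ⟩
    value G′ k Admirable (setLab M w true) + c ≤⟨ ℤ.+-monoˡ-≤ c (value-Impish-≥ G′ w∈) ⟩
    value G′ (suc k) Impish M + c              ∎
  value-≤ (suc k) Admirable {L} {M} r | inj₂ (x , x∈) =
    let w₀ , w₀∈ , _ = forth r x∈
        w , w∈ , eq = value-attained G′ {k} {Admirable} w₀∈
        y , y∈ , r′ = back r w∈
    in begin
    value G (suc k) Admirable L               ≤⟨ value-Admirable-≤ G y∈ ⟩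
    value G k Impish (setLab L y false)       ≤⟨ value-≤ k Impish (r′ false) ⟩
    value G′ k Impish (setLab M w false) + c  ≡⟨ cong (_+ c) eq ⟨
    value G′ (suc k) Admirable M + c          ∎

-- u is the vertex labelled b by the extra first move on G.
module Correspondence {m} (G : Graph (suc m)) (u v : Fin (suc m)) (b : Bool) where

  private
    G′ = delete G v
    c = + (2 *ℕ maxDeg G +ℕ deg G v)

  record Corresponds (L : Labeling (suc m)) (M : Labeling m) : Set where
    constructor corresponds
    field
      u-labelled : L u ≡ just b
      agrees     : ∀ w → L (ι u v w) ≡ M w

  initial : Corresponds (setLab emptyLab u b) emptyLab
  initial = corresponds (setLab-≡ emptyLab u b) λ w → setLab-≢ emptyLab b (ι-≢ u v w)

  corresponds-setLab : ∀ {L M} → Corresponds L M → ∀ w b′ →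
    Corresponds (setLab L (ι u v w) b′) (setLab M w b′)
  corresponds-setLab {L} {M} (corresponds Lu≡b L∘ι≗M) w b′ =
    corresponds (trans (setLab-≢ L b′ (ι-≢ u v w ∘ sym)) Lu≡b) agree
    where
    agree : ∀ w′ → setLab L (ι u v w) b′ (ι u v w′) ≡ setLab M w b′ w′
    agree w′ with w′ ≟ w
    ... | yes refl = setLab-≡ L (ι u v w) b′
    ... | no  w′≢w = trans (setLab-≢ L b′ (w′≢w ∘ ι-injective u v w′ w)) (L∘ι≗M w′)

  forth : ∀ {L M} → Corresponds L M → ∀ {x} → x ∈ unlabeled L →
    ∃[ w ] w ∈ unlabeled M × (∀ b′ → Corresponds (setLab L x b′) (setLab M w b′))
  forth {L} {M} r@(corresponds Lu≡b L∘ι≗M) {x} x∈ =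
    let w , ιw≡x = ι-surjective u v x x≢u in
    w , ∈-unlabeled⁺ M (trans (sym (L∘ι≗M w)) (trans (cong L ιw≡x) Lx≡nothing)) ,
    λ b′ → subst (λ y → Corresponds (setLab L y b′) (setLab M w b′)) ιw≡x
                 (corresponds-setLab r w b′)
    where
    Lx≡nothing = ∈-unlabeled⁻ L x∈
    x≢u : x ≢ u
    x≢u refl with trans (sym Lx≡nothing) Lu≡b
    ... | ()

  back : ∀ {L M} → Corresponds L M → ∀ {w} → w ∈ unlabeled M →
    ∃[ x ] x ∈ unlabeled L × (∀ b′ → Corresponds (setLab L x b′) (setLab M w b′))
  back {L} {M} r@(corresponds _ L∘ι≗M) {w} w∈ =
    ι u v w , ∈-unlabeled⁺ L (trans (L∘ι≗M w) (∈-unlabeled⁻ M w∈)) , corresponds-setLab r w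

  ∣disc-disc-delete∣≤2*maxDeg+deg : ∀ {L M} → Corresponds L M →
    ∣ disc G L - disc G′ M ∣ ≤ℕ 2 *ℕ maxDeg G +ℕ deg G v
  ∣disc-disc-delete∣≤2*maxDeg+deg {L} {M} (corresponds _ L∘ι≗M) = begin
    ∣ disc G L - disc G′ M ∣
      ≡⟨ cong₂ (λ d d′ → ∣ d - d′ ∣) (disc≡discrepancy G L) M-side ⟩
    ∣ discrepancy G (labelOf L) - discrepancy G′ (labelOf L ∘ ι u v) ∣
      ≤⟨ ∣discrepancy-delete-ι∣≤2*deg+deg u v G (labelOf L) ⟩
    2 *ℕ deg G u +ℕ deg G v
      ≤⟨ ℕ.+-monoˡ-≤ (deg G v) (ℕ.*-monoʳ-≤ 2 (deg≤maxDeg G u)) ⟩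
    2 *ℕ maxDeg G +ℕ deg G v
      ∎
    where
    open ℕ.≤-Reasoning
    M-side : disc G′ M ≡ discrepancy G′ (labelOf L ∘ ι u v)
    M-side = trans (disc≡discrepancy G′ M)
                   (discrepancy-cong G′ λ w → cong (fromMaybe false) (sym (L∘ι≗M w)))

  disc-≤ : ∀ {L M} → Corresponds L M → disc G L ≤ disc G′ M + c
  disc-≤ r = ∣i-j∣≤k⇒i≤j+k (∣disc-disc-delete∣≤2*maxDeg+deg r)

  disc-delete-≤ : ∀ {L M} → Corresponds L M → disc G′ M ≤ disc G L + c
  disc-delete-≤ {L} {M} r = ∣i-j∣≤k⇒i≤j+k
    (subst (_≤ℕ _) (ℤ.∣i-j∣≡∣j-i∣ (disc G L) (disc G′ M)) (∣disc-disc-delete∣≤2*maxDeg+deg r))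

module _ {m} (G : Graph (suc m)) (v : Fin (suc m)) where

  private
    G′ = delete G v
    c = + (2 *ℕ maxDeg G +ℕ deg G v)
    0∈unlabeled : Fin.zero ∈ unlabeled {suc m} emptyLab
    0∈unlabeled = ∈-unlabeled⁺ emptyLab refl
    open ℤ.≤-Reasoning

  bgI≤bgA-delete+ : bgI G ≤ bgA G′ + c
  bgI≤bgA-delete+ =
    let u , _ , first-move = value-attained G {m} {Impish} 0∈unlabeled
        open Correspondence G u v true
        open Simulation G G′ c Corresponds disc-≤ forth back
    in begin
    bgI G                                         ≡⟨ first-move ⟩
    value G m Admirable (setLab emptyLab u true)  ≤⟨ value-≤ m Admirable initial ⟩
    bgA G′ + c                                    ∎

  bgI-delete≤bgA+ : bgI G′ ≤ bgA G + c
  bgI-delete≤bgA+ =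
    let u , _ , first-move = value-attained G {m} {Admirable} 0∈unlabeled
        open Correspondence G u v false
        open Simulation G′ G c (λ M L → Corresponds L M) disc-delete-≤ back forth
    in begin
    bgI G′                                          ≤⟨ value-≤ m Impish initial ⟩
    value G m Impish (setLab emptyLab u false) + c  ≡⟨ cong (_+ c) first-move ⟨
    bgA G + c                                       ∎

lemma2p10 : ∀ {m} (G : Graph (suc m)) (v : Fin (suc m)) →
    (bgI G ≤ bgA (delete G v) + + 2 * + maxDeg G + + deg G v)
    × (bgI (delete G v) - + 2 * + maxDeg G - + deg G v ≤ bgA G)
lemma2p10 G v = first , second
  where
  open ℤ.≤-Reasoning
  G′ = delete G v
  c≡ : + (2 *ℕ maxDeg G +ℕ deg G v) ≡ + 2 * + maxDeg G + + deg G v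
  c≡ = trans (ℤ.pos-+ (2 *ℕ maxDeg G) (deg G v)) (cong (_+ + deg G v) (ℤ.pos-* 2 (maxDeg G)))
  first : bgI G ≤ bgA G′ + + 2 * + maxDeg G + + deg G v
  first = begin
    bgI G                                    ≤⟨ bgI≤bgA-delete+ G v ⟩
    bgA G′ + + (2 *ℕ maxDeg G +ℕ deg G v)    ≡⟨ cong (_+_ (bgA G′)) c≡ ⟩
    bgA G′ + (+ 2 * + maxDeg G + + deg G v)  ≡⟨ ℤ.+-assoc (bgA G′) _ _ ⟨
    bgA G′ + + 2 * + maxDeg G + + deg G v    ∎
  second : bgI G′ - + 2 * + maxDeg G - + deg G v ≤ bgA G
  second = i≤j+[k+l]⇒i-k-l≤j (subst (λ d → bgI G′ ≤ bgA G + d) c≡ (bgI-delete≤bgA+ G v))
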